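{- Every set of three positive integers is the score set of some oriented bipartite graph. That is, for all positive integers $a_1<a_2<a_3$ there is an oriented bipartite graph with score set $\{a_1,a_2,a_3\}$.
   Context: An oriented bipartite graph $D(U,V)$ is obtained by assigning a direction to each edge of a simple bipartite graph with parts $U=\{u_1,\dots,u_m\}$ and $V=\{v_1,\dots,v_n\}$. For a vertex $x$, let $d_x^+$ and $d_x^-$ denote its outdegree and indegree. The score of $u\in U$ is $a_u=n+d_u^+-d_u^-$ and the score of $v\in V$ is $b_v=m+d_v^+-d_v^-$. The score set of $D(U,V)$ is the set of distinct scores of all its vertices. -}

module Defs where

open import Data.Nat using (ℕ; zero; suc; _+_)
open import Data.Integer using (ℤ; +_; _-_)
open import Data.Fin using (Fin; zero; suc)
open import Data.Sum using (_⊎_; inj₁; inj₂)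
open import Data.Product using (∃)
open import Relation.Binary.PropositionalEquality using (_≡_)

-- Status of a pair (u , v) ∈ U × V in an oriented bipartite graph:
-- no edge, the edge oriented u → v, or the edge oriented v → u.
-- (A simple bipartite graph has at most one edge per pair; orienting it
-- chooses exactly one direction.)
data Arc : Set where
  none  : Arc
  u→v   : Arc
  v→u   : Arc

record OBG (m n : ℕ) : Set where
  field
    arc : Fin m → Fin n → Arc

sumFin : (k : ℕ) → (Fin k → ℕ) → ℕ
sumFin zero    f = 0
sumFin (suc k) f = f zero + sumFin k (λ i → f (suc i))

isOut : Arc → ℕ
isOut u→v = 1
isOut _   = 0

isIn : Arc → ℕ
isIn v→u = 1
isIn _   = 0

module _ {m n : ℕ} (D : OBG m n) where
  open OBG D

  outU inU : Fin m → ℕ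
  outU u = sumFin n (λ v → isOut (arc u v))
  inU  u = sumFin n (λ v → isIn  (arc u v))

  outV inV : Fin n → ℕ
  outV v = sumFin m (λ u → isIn  (arc u v))
  inV  v = sumFin m (λ u → isOut (arc u v))

  score : Fin m ⊎ Fin n → ℤ
  score (inj₁ u) = (+ (n + outU u)) - (+ inU u)
  score (inj₂ v) = (+ (m + outV v)) - (+ inV v)

  InScoreSet : ℤ → Set
  InScoreSet x = ∃ λ (w : Fin m ⊎ Fin n) → score w ≡ x

-- Split U = U₁ ⊎ U₂ and V = V₁ ⊎ V₂, orient every pair of U₁ × V₁ as u → v, give every
-- pair of U₂ × V₂ one common status c and leave all other pairs without an edge.  Each
-- class is then score-homogeneous: U₁ scores 2|V₁| + |V₂|, V₁ scores |U₂|, and U₂ and V₂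
-- score |V₁| + w|V₂| and |U₁| + (2 − w)|U₂|, where w = 2, 1, 0 as c is u → v, no edge,
-- v → u.  If a₃ ≤ 2a₂, the sizes |U₁|, |U₂|, |V₁|, |V₂| = a₂ − a₁, a₁, a₃ − a₂, 2a₂ − a₃
-- with no U₂–V₂ edges give the class scores a₃, a₁, a₂, a₂; otherwise the sizes
-- a₃ − 2a₂, a₂, a₁, a₃ − 2a₁ with c = v → u give a₃, a₂, a₁, a₃.  The classes exhibiting
-- a₁, a₂, a₃ are nonempty; the others may be empty.

module Submission where

open import Defs
open import Data.Nat using (ℕ; _+_; _*_; _∸_; _≤_; _<_)
open import Data.Nat.Properties
  using (+-assoc; +-comm; +-identityʳ; *-identityʳ; *-zeroʳ; ≤-total; <⇒≤; <-trans; <-≤-trans;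
         +-mono-<; m≤m+n; m+n∸m≡n; m+[n∸m]≡n; m∸n+n≡m; m<n⇒0<n∸m; m≤n+o⇒m∸n≤o)
open import Data.Integer as ℤ using (ℤ; +_; _-_; _⊖_)
import Data.Integer.Properties as ℤ
open import Data.Fin using (Fin; zero; suc; splitAt; _↑ˡ_; _↑ʳ_; fromℕ<)
open import Data.Fin.Properties using (splitAt-↑ˡ; splitAt-↑ʳ; splitAt⁻¹-↑ˡ; splitAt⁻¹-↑ʳ)
open import Data.Product using (Σ; ∃; _,_)
open import Data.Sum using (_⊎_; inj₁; inj₂; map₁)
open import Function.Bundles using (_⇔_; mk⇔)
open import Relation.Binary.PropositionalEquality using (_≡_; refl; sym; trans; cong; cong₂)
open Relation.Binary.PropositionalEquality.≡-Reasoning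

sumFin-splitAt : ∀ a b (g : Fin a ⊎ Fin b → ℕ) →
  sumFin (a + b) (λ i → g (splitAt a i)) ≡ sumFin a (λ i → g (inj₁ i)) + sumFin b (λ i → g (inj₂ i))
sumFin-splitAt ℕ.zero    b g = refl
sumFin-splitAt (ℕ.suc a) b g =
  trans (cong (_+_ (g (inj₁ zero))) (sumFin-splitAt a b (λ t → g (map₁ suc t))))
        (sym (+-assoc (g (inj₁ zero)) _ _))

sumFin-const : ∀ k c → sumFin k (λ _ → c) ≡ k * c
sumFin-const ℕ.zero    c = refl
sumFin-const (ℕ.suc k) c = cong (_+_ c) (sumFin-const k c)

-- score D (inj₁ u) is definitionally netScore n (outU D u) (inU D u), and dually for V.
netScore : ℕ → ℕ → ℕ → ℤ
netScore k o i = + (k + o) - + i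

netScore-≡ : ∀ k o i {s} → k + o ≡ i + s → netScore k o i ≡ + s
netScore-≡ k o i {s} k+o≡i+s = begin
  + (k + o) - + i  ≡⟨ cong (λ z → + z - + i) k+o≡i+s ⟩
  + (i + s) - + i  ≡⟨ ℤ.[+m]-[+n]≡m⊖n (i + s) i ⟩
  (i + s) ⊖ i      ≡⟨ ℤ.⊖-≥ (m≤m+n i s) ⟩
  + (i + s ∸ i)    ≡⟨ cong +_ (m+n∸m≡n i s) ⟩
  + s              ∎

netScore-+ : ∀ a b o i → netScore (a + b) o i ≡ + a ℤ.+ netScore b o i
netScore-+ a b o i = begin
  + (a + b + o) - + i          ≡⟨ cong (λ z → + z - + i) (+-assoc a b o) ⟩
  + a ℤ.+ + (b + o) - + i      ≡⟨ ℤ.+-assoc (+ a) (+ (b + o)) (ℤ.- + i) ⟩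
  + a ℤ.+ (+ (b + o) - + i)    ∎

rowSum : ∀ {m n} → (Arc → ℕ) → OBG m n → Fin m → ℕ
rowSum {n = n} f D u = sumFin n (λ v → f (OBG.arc D u v))

colSum : ∀ {m n} → (Arc → ℕ) → OBG m n → Fin n → ℕ
colSum {m = m} f D v = sumFin m (λ u → f (OBG.arc D u v))

complete : (m n : ℕ) → Arc → OBG m n
complete m n c = record { arc = λ _ _ → c }

reverse : Arc → Arc
reverse none = none
reverse u→v  = v→u
reverse v→u  = u→v

completeScore : Arc → ℕ → ℕ
completeScore none n = n
completeScore u→v  n = n + n
completeScore v→u  n = 0

netScore-uniform : ∀ c k →
  netScore k (sumFin k (λ _ → isOut c)) (sumFin k (λ _ → isIn c)) ≡ + completeScore c k
netScore-uniform none k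
  rewrite sumFin-const k 0 | *-zeroʳ k = netScore-≡ k 0 0 (+-identityʳ k)
netScore-uniform u→v k
  rewrite sumFin-const k 1 | sumFin-const k 0 | *-identityʳ k | *-zeroʳ k = netScore-≡ k k 0 refl
netScore-uniform v→u k
  rewrite sumFin-const k 1 | sumFin-const k 0 | *-identityʳ k | *-zeroʳ k = netScore-≡ k 0 k refl

score-completeᵁ : ∀ {m n} c (u : Fin m) → score (complete m n c) (inj₁ u) ≡ + completeScore c n
score-completeᵁ {n = n} c _ = netScore-uniform c n

score-completeⱽ : ∀ {m n} c (v : Fin n) → score (complete m n c) (inj₂ v) ≡ + completeScore (reverse c) m
score-completeⱽ {m} none _ = netScore-uniform none m
score-completeⱽ {m} u→v  _ = netScore-uniform v→u m
score-completeⱽ {m} v→u  _ = netScore-uniform u→v m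

blockArc : ∀ {m₁ n₁ m₂ n₂} → OBG m₁ n₁ → OBG m₂ n₂ → Fin m₁ ⊎ Fin m₂ → Fin n₁ ⊎ Fin n₂ → Arc
blockArc D₁ D₂ (inj₁ u) (inj₁ v) = OBG.arc D₁ u v
blockArc D₁ D₂ (inj₂ u) (inj₂ v) = OBG.arc D₂ u v
blockArc D₁ D₂ _        _        = none

infixr 5 _⊕_
_⊕_ : ∀ {m₁ n₁ m₂ n₂} → OBG m₁ n₁ → OBG m₂ n₂ → OBG (m₁ + m₂) (n₁ + n₂)
_⊕_ {m₁} {n₁} D₁ D₂ = record { arc = λ u v → blockArc D₁ D₂ (splitAt m₁ u) (splitAt n₁ v) }

sumFin-none : ∀ (f : Arc → ℕ) → f none ≡ 0 → ∀ k → sumFin k (λ _ → f none) ≡ 0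
sumFin-none f f-none k = trans (sumFin-const k (f none)) (trans (cong (k *_) f-none) (*-zeroʳ k))

module _ {m₁ n₁ m₂ n₂} (D₁ : OBG m₁ n₁) (D₂ : OBG m₂ n₂) where

  module _ (f : Arc → ℕ) (f-none : f none ≡ 0) where

    rowSum-⊕ˡ : ∀ u → rowSum f (D₁ ⊕ D₂) (u ↑ˡ m₂) ≡ rowSum f D₁ u
    rowSum-⊕ˡ u rewrite splitAt-↑ˡ m₁ u m₂ = begin
      sumFin (n₁ + n₂) (λ v → f (blockArc D₁ D₂ (inj₁ u) (splitAt n₁ v)))
        ≡⟨ sumFin-splitAt n₁ n₂ (λ t → f (blockArc D₁ D₂ (inj₁ u) t)) ⟩
      rowSum f D₁ u + sumFin n₂ (λ _ → f none)
        ≡⟨ cong (_+_ (rowSum f D₁ u)) (sumFin-none f f-none n₂) ⟩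
      rowSum f D₁ u + 0
        ≡⟨ +-identityʳ _ ⟩
      rowSum f D₁ u ∎

    rowSum-⊕ʳ : ∀ u → rowSum f (D₁ ⊕ D₂) (m₁ ↑ʳ u) ≡ rowSum f D₂ u
    rowSum-⊕ʳ u rewrite splitAt-↑ʳ m₁ m₂ u =
      trans (sumFin-splitAt n₁ n₂ (λ t → f (blockArc D₁ D₂ (inj₂ u) t)))
            (cong (_+ rowSum f D₂ u) (sumFin-none f f-none n₁))

    colSum-⊕ˡ : ∀ v → colSum f (D₁ ⊕ D₂) (v ↑ˡ n₂) ≡ colSum f D₁ v
    colSum-⊕ˡ v rewrite splitAt-↑ˡ n₁ v n₂ =
      trans (sumFin-splitAt m₁ m₂ (λ s → f (blockArc D₁ D₂ s (inj₁ v))))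
            (trans (cong (_+_ (colSum f D₁ v)) (sumFin-none f f-none m₂)) (+-identityʳ _))

    colSum-⊕ʳ : ∀ v → colSum f (D₁ ⊕ D₂) (n₁ ↑ʳ v) ≡ colSum f D₂ v
    colSum-⊕ʳ v rewrite splitAt-↑ʳ n₁ n₂ v =
      trans (sumFin-splitAt m₁ m₂ (λ s → f (blockArc D₁ D₂ s (inj₂ v))))
            (cong (_+ colSum f D₂ v) (sumFin-none f f-none m₁))

  score-⊕ᵁˡ : ∀ u → score (D₁ ⊕ D₂) (inj₁ (u ↑ˡ m₂)) ≡ + n₂ ℤ.+ score D₁ (inj₁ u)
  score-⊕ᵁˡ u = begin
    netScore (n₁ + n₂) (rowSum isOut (D₁ ⊕ D₂) (u ↑ˡ m₂)) (rowSum isIn (D₁ ⊕ D₂) (u ↑ˡ m₂))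
      ≡⟨ cong₂ (netScore (n₁ + n₂)) (rowSum-⊕ˡ isOut refl u) (rowSum-⊕ˡ isIn refl u) ⟩
    netScore (n₁ + n₂) (outU D₁ u) (inU D₁ u)
      ≡⟨ cong (λ k → netScore k (outU D₁ u) (inU D₁ u)) (+-comm n₁ n₂) ⟩
    netScore (n₂ + n₁) (outU D₁ u) (inU D₁ u)
      ≡⟨ netScore-+ n₂ n₁ (outU D₁ u) (inU D₁ u) ⟩
    + n₂ ℤ.+ score D₁ (inj₁ u) ∎

  score-⊕ᵁʳ : ∀ u → score (D₁ ⊕ D₂) (inj₁ (m₁ ↑ʳ u)) ≡ + n₁ ℤ.+ score D₂ (inj₁ u)
  score-⊕ᵁʳ u =
    trans (cong₂ (netScore (n₁ + n₂)) (rowSum-⊕ʳ isOut refl u) (rowSum-⊕ʳ isIn refl u))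
          (netScore-+ n₁ n₂ (outU D₂ u) (inU D₂ u))

  score-⊕ⱽˡ : ∀ v → score (D₁ ⊕ D₂) (inj₂ (v ↑ˡ n₂)) ≡ + m₂ ℤ.+ score D₁ (inj₂ v)
  score-⊕ⱽˡ v = begin
    netScore (m₁ + m₂) (colSum isIn (D₁ ⊕ D₂) (v ↑ˡ n₂)) (colSum isOut (D₁ ⊕ D₂) (v ↑ˡ n₂))
      ≡⟨ cong₂ (netScore (m₁ + m₂)) (colSum-⊕ˡ isIn refl v) (colSum-⊕ˡ isOut refl v) ⟩
    netScore (m₁ + m₂) (outV D₁ v) (inV D₁ v)
      ≡⟨ cong (λ k → netScore k (outV D₁ v) (inV D₁ v)) (+-comm m₁ m₂) ⟩
    netScore (m₂ + m₁) (outV D₁ v) (inV D₁ v)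
      ≡⟨ netScore-+ m₂ m₁ (outV D₁ v) (inV D₁ v) ⟩
    + m₂ ℤ.+ score D₁ (inj₂ v) ∎

  score-⊕ⱽʳ : ∀ v → score (D₁ ⊕ D₂) (inj₂ (n₁ ↑ʳ v)) ≡ + m₁ ℤ.+ score D₂ (inj₂ v)
  score-⊕ⱽʳ v =
    trans (cong₂ (netScore (m₁ + m₂)) (colSum-⊕ʳ isIn refl v) (colSum-⊕ʳ isOut refl v))
          (netScore-+ m₁ m₂ (outV D₂ v) (inV D₂ v))

↑ˡ⊎↑ʳ : ∀ m {n} (i : Fin (m + n)) → (∃ λ j → j ↑ˡ n ≡ i) ⊎ (∃ λ k → m ↑ʳ k ≡ i)
↑ˡ⊎↑ʳ m i with splitAt m i in eq
... | inj₁ j = inj₁ (j , splitAt⁻¹-↑ˡ eq)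
... | inj₂ k = inj₂ (k , splitAt⁻¹-↑ʳ eq)

module TwoBlocks (α β γ δ : ℕ) (c : Arc) where

  graph : OBG (α + β) (γ + δ)
  graph = complete α γ u→v ⊕ complete β δ c

  score-U₁ : ∀ i → score graph (inj₁ (i ↑ˡ β)) ≡ + (δ + (γ + γ))
  score-U₁ i = trans (score-⊕ᵁˡ (complete α γ u→v) (complete β δ c) i)
                     (cong (ℤ._+_ (+ δ)) (score-completeᵁ {n = γ} u→v i))

  score-V₁ : ∀ j → score graph (inj₂ (j ↑ˡ δ)) ≡ + β
  score-V₁ j = trans (score-⊕ⱽˡ (complete α γ u→v) (complete β δ c) j)
                     (trans (cong (ℤ._+_ (+ β)) (score-completeⱽ {α} u→v j)) (cong +_ (+-identityʳ β)))

  score-U₂ : ∀ i → score graph (inj₁ (α ↑ʳ i)) ≡ + (γ + completeScore c δ)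
  score-U₂ i = trans (score-⊕ᵁʳ (complete α γ u→v) (complete β δ c) i)
                     (cong (ℤ._+_ (+ γ)) (score-completeᵁ {n = δ} c i))

  score-V₂ : ∀ j → score graph (inj₂ (γ ↑ʳ j)) ≡ + (α + completeScore (reverse c) β)
  score-V₂ j = trans (score-⊕ⱽʳ (complete α γ u→v) (complete β δ c) j)
                     (cong (ℤ._+_ (+ α)) (score-completeⱽ {β} c j))

  IsClassScore : ℤ → Set
  IsClassScore x = x ≡ + (δ + (γ + γ)) ⊎ x ≡ + β
                 ⊎ x ≡ + (γ + completeScore c δ) ⊎ x ≡ + (α + completeScore (reverse c) β)

  score-isClassScore : ∀ w → IsClassScore (score graph w)
  score-isClassScore (inj₁ u) with ↑ˡ⊎↑ʳ α u
  ... | inj₁ (i , refl) = inj₁ (score-U₁ i)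
  ... | inj₂ (i , refl) = inj₂ (inj₂ (inj₁ (score-U₂ i)))
  score-isClassScore (inj₂ v) with ↑ˡ⊎↑ʳ γ v
  ... | inj₁ (j , refl) = inj₂ (inj₁ (score-V₁ j))
  ... | inj₂ (j , refl) = inj₂ (inj₂ (inj₂ (score-V₂ j)))

HasScoreSet : ∀ {m n} → OBG m n → ℕ → ℕ → ℕ → Set
HasScoreSet D a₁ a₂ a₃ = ∀ x → InScoreSet D x ⇔ (x ≡ + a₁ ⊎ x ≡ + a₂ ⊎ x ≡ + a₃)

module _ {a₁ a₂ a₃ : ℕ} (0<a₁ : 0 < a₁) (a₁<a₂ : a₁ < a₂) (a₂<a₃ : a₂ < a₃) where

  hasScoreSet-a₃≤2a₂ : (a₃≤2a₂ : a₃ ≤ a₂ + a₂) →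
    HasScoreSet (TwoBlocks.graph (a₂ ∸ a₁) a₁ (a₃ ∸ a₂) (a₂ ∸ (a₃ ∸ a₂)) none) a₁ a₂ a₃
  hasScoreSet-a₃≤2a₂ a₃≤2a₂ x = mk⇔ sound attained
    where
    open TwoBlocks (a₂ ∸ a₁) a₁ (a₃ ∸ a₂) (a₂ ∸ (a₃ ∸ a₂)) none
    γ : ℕ
    γ = a₃ ∸ a₂
    γ≤a₂ : γ ≤ a₂
    γ≤a₂ = m≤n+o⇒m∸n≤o a₃ a₂ a₃≤2a₂
    U₂≡a₂ : γ + (a₂ ∸ γ) ≡ a₂
    U₂≡a₂ = m+[n∸m]≡n γ≤a₂
    U₁≡a₃ : (a₂ ∸ γ) + (γ + γ) ≡ a₃
    U₁≡a₃ = begin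
      (a₂ ∸ γ) + (γ + γ) ≡⟨ sym (+-assoc (a₂ ∸ γ) γ γ) ⟩
      (a₂ ∸ γ) + γ + γ   ≡⟨ cong (_+ γ) (m∸n+n≡m γ≤a₂) ⟩
      a₂ + γ             ≡⟨ m+[n∸m]≡n (<⇒≤ a₂<a₃) ⟩
      a₃                 ∎
    V₂≡a₂ : (a₂ ∸ a₁) + a₁ ≡ a₂
    V₂≡a₂ = m∸n+n≡m (<⇒≤ a₁<a₂)
    sound : ∀ {x} → InScoreSet graph x → x ≡ + a₁ ⊎ x ≡ + a₂ ⊎ x ≡ + a₃
    sound (w , refl) with score-isClassScore w
    ... | inj₁ e               = inj₂ (inj₂ (trans e (cong +_ U₁≡a₃)))
    ... | inj₂ (inj₁ e)        = inj₁ e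
    ... | inj₂ (inj₂ (inj₁ e)) = inj₂ (inj₁ (trans e (cong +_ U₂≡a₂)))
    ... | inj₂ (inj₂ (inj₂ e)) = inj₂ (inj₁ (trans e (cong +_ V₂≡a₂)))
    attained : ∀ {x} → x ≡ + a₁ ⊎ x ≡ + a₂ ⊎ x ≡ + a₃ → InScoreSet graph x
    attained (inj₁ refl)        = let j = fromℕ< (m<n⇒0<n∸m a₂<a₃) in
                                  inj₂ (j ↑ˡ _) , score-V₁ j
    attained (inj₂ (inj₁ refl)) = let i = fromℕ< 0<a₁ in
                                  inj₁ (_ ↑ʳ i) , trans (score-U₂ i) (cong +_ U₂≡a₂)
    attained (inj₂ (inj₂ refl)) = let i = fromℕ< (m<n⇒0<n∸m a₁<a₂) in
                                  inj₁ (i ↑ˡ _) , trans (score-U₁ i) (cong +_ U₁≡a₃)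

  hasScoreSet-2a₂≤a₃ : (2a₂≤a₃ : a₂ + a₂ ≤ a₃) →
    HasScoreSet (TwoBlocks.graph (a₃ ∸ (a₂ + a₂)) a₂ a₁ (a₃ ∸ (a₁ + a₁)) v→u) a₁ a₂ a₃
  hasScoreSet-2a₂≤a₃ 2a₂≤a₃ x = mk⇔ sound attained
    where
    open TwoBlocks (a₃ ∸ (a₂ + a₂)) a₂ a₁ (a₃ ∸ (a₁ + a₁)) v→u
    2a₁<a₃ : a₁ + a₁ < a₃
    2a₁<a₃ = <-≤-trans (+-mono-< a₁<a₂ a₁<a₂) 2a₂≤a₃
    U₁≡a₃ : (a₃ ∸ (a₁ + a₁)) + (a₁ + a₁) ≡ a₃
    U₁≡a₃ = m∸n+n≡m (<⇒≤ 2a₁<a₃)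
    V₂≡a₃ : (a₃ ∸ (a₂ + a₂)) + (a₂ + a₂) ≡ a₃
    V₂≡a₃ = m∸n+n≡m 2a₂≤a₃
    sound : ∀ {x} → InScoreSet graph x → x ≡ + a₁ ⊎ x ≡ + a₂ ⊎ x ≡ + a₃
    sound (w , refl) with score-isClassScore w
    ... | inj₁ e               = inj₂ (inj₂ (trans e (cong +_ U₁≡a₃)))
    ... | inj₂ (inj₁ e)        = inj₂ (inj₁ e)
    ... | inj₂ (inj₂ (inj₁ e)) = inj₁ (trans e (cong +_ (+-identityʳ a₁)))
    ... | inj₂ (inj₂ (inj₂ e)) = inj₂ (inj₂ (trans e (cong +_ V₂≡a₃)))
    attained : ∀ {x} → x ≡ + a₁ ⊎ x ≡ + a₂ ⊎ x ≡ + a₃ → InScoreSet graph x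
    attained (inj₁ refl)        = let i = fromℕ< (<-trans 0<a₁ a₁<a₂) in
                                  inj₁ (_ ↑ʳ i) , trans (score-U₂ i) (cong +_ (+-identityʳ a₁))
    attained (inj₂ (inj₁ refl)) = let j = fromℕ< 0<a₁ in
                                  inj₂ (j ↑ˡ _) , score-V₁ j
    attained (inj₂ (inj₂ refl)) = let j = fromℕ< (m<n⇒0<n∸m 2a₁<a₃) in
                                  inj₂ (_ ↑ʳ j) , trans (score-V₂ j) (cong +_ V₂≡a₃)

theorem2p2 : (a₁ a₂ a₃ : ℕ) → 0 < a₁ → a₁ < a₂ → a₂ < a₃ →
    ∃ λ (m : ℕ) → ∃ λ (n : ℕ) → Σ (OBG m n) λ D →
      (x : ℤ) → InScoreSet D x ⇔ (x ≡ + a₁ ⊎ x ≡ + a₂ ⊎ x ≡ + a₃)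
theorem2p2 a₁ a₂ a₃ 0<a₁ a₁<a₂ a₂<a₃ with ≤-total a₃ (a₂ + a₂)
... | inj₁ a₃≤2a₂ = _ , _ , _ , hasScoreSet-a₃≤2a₂ 0<a₁ a₁<a₂ a₂<a₃ a₃≤2a₂
... | inj₂ 2a₂≤a₃ = _ , _ , _ , hasScoreSet-2a₂≤a₃ 0<a₁ a₁<a₂ a₂<a₃ 2a₂≤a₃
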